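{- Let $\alpha=(\alpha_1,\alpha_2,\ldots,\alpha_\ell)$ be a composition. Then \[ \mathfrak{S}^*_\alpha=h_{\alpha_1}\prec\left(h_{\alpha_2}\prec\left(\cdots\prec\left(h_{\alpha_\ell}\prec 1\right)\cdots\right)\right). \]
   Context: Let $\mathbf{k}$ be a commutative ring and $\mathbf{k}[[x_1,x_2,\ldots]]$ the ring of formal power series in commuting indeterminates, with the product topology. For a monomial $\mathfrak m=x_1^{a_1}x_2^{a_2}\cdots$, $\mathrm{Supp}\,\mathfrak m=\{i:a_i>0\}$, with $\min\varnothing=\infty$. $\prec$ is the unique $\mathbf{k}$-bilinear continuous binary operation with $\mathfrak m\prec\mathfrak n=\mathfrak m\mathfrak n$ if $\min(\mathrm{Supp}\,\mathfrak m)<\min(\mathrm{Supp}\,\mathfrak n)$ and $0$ otherwise. $h_n=\sum_{1\le i_1\le\cdots\le i_n}x_{i_1}\cdots x_{i_n}$. A composition is a finite sequence of positive integers, $|\alpha|$ its sum; $M_\beta=\sum_{1\le i_1<\cdots<i_k}x_{i_1}^{\beta_1}\cdots x_{i_k}^{\beta_k}$. For $\alpha=(\alpha_1,\ldots,\alpha_\ell)$, $Y(\alpha)=\{(i,j):1\le i\le\ell,1\le j\le\alpha_i\}$; an immaculate tableau of shape $\alpha$ is a map $T:Y(\alpha)\to\{1,2,\ldots\}$ with $T(i,1)<T(j,1)$ for $i<j$ and $T(i,u)\le T(i,v)$ for $u<v$. $T$ has content $\beta=(\beta_1,\ldots,\beta_k)$ if $|T^{ -1}(j)|=\beta_j$ for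 $j\le k$ and $0$ for $j>k$; $K_{\alpha,\beta}$ is the number of immaculate tableaux of shape $\alpha$ and content $\beta$; $\mathfrak{S}^*_\alpha=\sum_\beta K_{\alpha,\beta}M_\beta$ over compositions $\beta$ of $|\alpha|$. -}

module Defs where

open import Level using (Level)
open import Data.Bool using (Bool; true; false; if_then_else_; _∧_)
open import Data.Nat using (ℕ; zero; suc; _∸_; _≡ᵇ_; _<ᵇ_; _≤ᵇ_)
open import Data.Maybe using (Maybe; just; nothing)
open import Data.List using (List; []; _∷_; map; concatMap; concat; zipWith; filter; length; upTo; foldr)
open import Data.Nat.ListAction using (sum)
open import Relation.Nullary.Decidable using (yes; no)
open import Data.Bool using (T)
open import Data.Bool.Properties using (T?)
open import Algebra.Bundles using (CommutativeRing)

-- Monomials in x₁, x₂, … : a monomial x₁^a₁ x₂^a₂ ⋯ is represented by the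
-- finite list of exponents (a₁ , a₂ , … , aₙ) (later exponents are 0).
-- Lists differing only by trailing zeros represent the same monomial;
-- every definition below is invariant under this.

Monomial : Set
Monomial = List ℕ

deg : Monomial → ℕ
deg = sum

-- min Supp m, with nothing = ∞ (indices are 0-based: x₁ ↦ 0; only the
-- comparison matters).
minSupp : Monomial → Maybe ℕ
minSupp [] = nothing
minSupp (zero ∷ w) with minSupp w
... | just i  = just (suc i)
... | nothing = nothing
minSupp (suc _ ∷ w) = just zero

_<∞_ : Maybe ℕ → Maybe ℕ → Bool
just i  <∞ just j  = i <ᵇ j
just i  <∞ nothing = true
nothing <∞ _       = false

divisors : Monomial → List Monomial
divisors [] = [] ∷ []
divisors (e ∷ w) = concatMap (λ a → map (a ∷_) (divisors w)) (upTo (suc e))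

quot : Monomial → Monomial → Monomial
quot w m = zipWith _∸_ w m

-- the positive-integer list of nonzero exponents of w, in order of index
-- (so M_β has coefficient 1 at w iff nonzeroExps w ≡ β)
nonzeroExps : Monomial → List ℕ
nonzeroExps [] = []
nonzeroExps (zero ∷ w) = nonzeroExps w
nonzeroExps (suc a ∷ w) = suc a ∷ nonzeroExps w

listEqᵇ : List ℕ → List ℕ → Bool
listEqᵇ [] [] = true
listEqᵇ [] (_ ∷ _) = false
listEqᵇ (_ ∷ _) [] = false
listEqᵇ (a ∷ u) (b ∷ v) = (a ≡ᵇ b) ∧ listEqᵇ u v

compositionsF : ℕ → ℕ → List (List ℕ)
compositionsF _ zero = [] ∷ []
compositionsF zero (suc n) = []
compositionsF (suc f) (suc n) =
  concatMap (λ k → map (suc k ∷_) (compositionsF f (n ∸ k))) (upTo (suc n))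

compositions : ℕ → List (List ℕ)
compositions n = compositionsF n n

-- Immaculate tableaux. A filling of shape α = (α₁,…,α_ℓ) is a list of
-- rows, row i being the list (T(i,1), …, T(i,αᵢ)).

oneTo : ℕ → List ℕ
oneTo k = map suc (upTo k)

allRows : ℕ → ℕ → List (List ℕ)
allRows zero k = [] ∷ []
allRows (suc a) k = concatMap (λ v → map (v ∷_) (allRows a k)) (oneTo k)

allFillings : List ℕ → ℕ → List (List (List ℕ))
allFillings [] k = [] ∷ []
allFillings (a ∷ α) k = concatMap (λ r → map (r ∷_) (allFillings α k)) (allRows a k)

weaklyIncr : List ℕ → Bool
weaklyIncr [] = true
weaklyIncr (a ∷ []) = true
weaklyIncr (a ∷ b ∷ u) = (a ≤ᵇ b) ∧ weaklyIncr (b ∷ u)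

strictlyIncr : List ℕ → Bool
strictlyIncr [] = true
strictlyIncr (a ∷ []) = true
strictlyIncr (a ∷ b ∷ u) = (a <ᵇ b) ∧ strictlyIncr (b ∷ u)

allᵇ : {A : Set} → (A → Bool) → List A → Bool
allᵇ p [] = true
allᵇ p (x ∷ xs) = p x ∧ allᵇ p xs

firstColumn : List (List ℕ) → List ℕ
firstColumn [] = []
firstColumn ([] ∷ T) = firstColumn T
firstColumn ((a ∷ _) ∷ T) = a ∷ firstColumn T

countᵇ : ℕ → List ℕ → ℕ
countᵇ j [] = 0
countᵇ j (a ∷ u) = if j ≡ᵇ a then suc (countᵇ j u) else countᵇ j u

isImmaculate : List (List ℕ) → Bool
isImmaculate T = strictlyIncr (firstColumn T) ∧ allᵇ weaklyIncr T

-- content β = (β₁,…,β_k): |T⁻¹(j)| = βⱼ for j ≤ k (entries are in [1..k],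
-- so |T⁻¹(j)| = 0 for j > k automatically)
hasContent : List ℕ → List (List ℕ) → Bool
hasContent β T = listEqᵇ (map (λ j → countᵇ j (concat T)) (oneTo (length β))) β

-- K_{α,β}: number of immaculate tableaux of shape α and content β.
-- Any tableau with content β has entries in [1..length β], so it suffices
-- to enumerate fillings with entries in that range.
K : List ℕ → List ℕ → ℕ
K α β = length (filter (λ T → T? (isImmaculate T ∧ hasContent β T))
                       (allFillings α (length β)))

module PowerSeries {c ℓ : Level} (R : CommutativeRing c ℓ) where
  open CommutativeRing R

  PS : Set c
  PS = Monomial → Carrier

  _≋_ : PS → PS → Set ℓ
  f ≋ g = (w : Monomial) → f w ≈ g w

  Σᴿ : List Carrier → Carrier
  Σᴿ = foldr _+_ 0#

  ι : ℕ → Carrier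
  ι zero = 0#
  ι (suc n) = 1# + ι n

  [_]ᴿ : Bool → Carrier
  [ b ]ᴿ = if b then 1# else 0#

  one : PS
  one w = [ deg w ≡ᵇ 0 ]ᴿ

  h : ℕ → PS
  h n w = [ deg w ≡ᵇ n ]ᴿ

  M : List ℕ → PS
  M β w = [ listEqᵇ (nonzeroExps w) β ]ᴿ

  dualImm : List ℕ → PS
  dualImm α w = Σᴿ (map (λ β → ι (K α β) * M β w) (compositions (sum α)))

  -- the continuous bilinear extension of  m ≺ n = m n  if
  -- min Supp m < min Supp n, and 0 otherwise:
  -- coefficient of w in f ≺ g is Σ_{m n = w, minSupp m < minSupp n} f_m g_n.
  _≺_ : PS → PS → PS
  (f ≺ g) w = Σᴿ (map (λ m → if minSupp m <∞ minSupp (quot w m)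
                               then f m * g (quot w m) else 0#)
                      (divisors w))

  infixr 6 _≺_

  nestedH : List ℕ → PS
  nestedH [] = one
  nestedH (a ∷ α) = h a ≺ nestedH α

-- Both sides have coefficients in the image of ℕ, so it suffices to compare natural-number
-- coefficients. Deleting the first row of an immaculate tableau of shape (a, α) and content v
-- leaves an immaculate tableau of shape α and content v / m, where m is the content of the
-- deleted row. That row is weakly increasing, hence determined by m, a divisor of x^v of
-- degree a; and since the top-left entry of an immaculate tableau is its smallest entry, the
-- strict increase of the first column says exactly min Supp m < min Supp (v / m). So K
-- satisfies the recursion defining the coefficients of h_{α₁} ≺ (⋯ ≺ (h_{α_ℓ} ≺ 1)). Finally,
-- the coefficient of x^w in 𝔖*_α is K_{α,β} for the composition β of nonzero exponents of w
-- (or 0 if deg w ≠ |α|), and the right-hand side is unchanged by deleting zero exponents and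
-- vanishes off degree |α|.

module Submission where

open import Defs
open import Level using (Level)
open import Algebra.Bundles using (CommutativeMonoid; CommutativeRing)
import Algebra.Properties.CommutativeSemigroup as CommutativeSemigroupProperties
open import Data.Bool using (Bool; true; false; if_then_else_; _∧_; T)
open import Data.Bool.Properties
  using (T?; ∧-zeroʳ; ∧-identityʳ; ∧-comm; ∧-assoc; ∧-commutativeMonoid; ⇔→≡)
open import Data.Empty using (⊥-elim)
open import Data.List
  using (List; []; _∷_; _++_; map; concatMap; concat; zipWith; filter; length; upTo; applyUpTo;
         replicate; head)
open import Data.List.Properties using (length-++; length-replicate; ++-assoc; map-upTo)
open import Data.List.Relation.Unary.All as All using (All; []; _∷_)
open import Data.List.Relation.Unary.All.Properties using (all-upTo; ++⁺; map⁺; concat⁺)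
open import Data.Maybe as Maybe using (just; nothing)
open import Data.Maybe.Relation.Unary.All as MaybeAll using (just; nothing)
open import Data.Nat
  using (ℕ; zero; suc; _+_; _*_; _∸_; _≡ᵇ_; _<ᵇ_; _≤_; _<_; z≤n; s≤s; s≤s⁻¹; z<s; _≟_)
open import Data.Nat.ListAction using (sum)
open import Data.Nat.ListAction.Properties using (sum-++)
open import Data.Nat.Properties
open import Data.Product using (_×_; _,_; proj₁)
open import Function using (_∘_; id)
open import Function.Bundles using (mk⇔)
open import Relation.Binary.PropositionalEquality
open import Relation.Nullary using (Dec; yes; no)

private
  variable
    A B : Set

open CommutativeSemigroupProperties +-commutativeSemigroup
  using () renaming (interchange to +-interchange)
open CommutativeSemigroupProperties (CommutativeMonoid.commutativeSemigroup ∧-commutativeMonoid)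
  using () renaming (interchange to ∧-interchange; x∙yz≈y∙xz to ∧-swapˡ)

∑ : (A → ℕ) → List A → ℕ
∑ f [] = 0
∑ f (x ∷ xs) = f x + ∑ f xs

∑-cong : {f g : A → ℕ} (xs : List A) → (∀ x → f x ≡ g x) → ∑ f xs ≡ ∑ g xs
∑-cong [] e = refl
∑-cong (x ∷ xs) e = cong₂ _+_ (e x) (∑-cong xs e)

∑-cong-All : {P : A → Set} {f g : A → ℕ} {xs : List A} →
  All P xs → (∀ x → P x → f x ≡ g x) → ∑ f xs ≡ ∑ g xs
∑-cong-All [] e = refl
∑-cong-All {xs = x ∷ xs} (px ∷ pxs) e = cong₂ _+_ (e x px) (∑-cong-All pxs e)

∑-0 : (xs : List A) → ∑ (λ _ → 0) xs ≡ 0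
∑-0 [] = refl
∑-0 (x ∷ xs) = ∑-0 xs

∑-++ : (f : A → ℕ) (xs ys : List A) → ∑ f (xs ++ ys) ≡ ∑ f xs + ∑ f ys
∑-++ f [] ys = refl
∑-++ f (x ∷ xs) ys = trans (cong (f x +_) (∑-++ f xs ys)) (sym (+-assoc (f x) _ _))

∑-map : (f : B → ℕ) (g : A → B) (xs : List A) → ∑ f (map g xs) ≡ ∑ (f ∘ g) xs
∑-map f g [] = refl
∑-map f g (x ∷ xs) = cong (f (g x) +_) (∑-map f g xs)

∑-concatMap : (f : B → ℕ) (g : A → List B) (xs : List A) →
  ∑ f (concatMap g xs) ≡ ∑ (λ x → ∑ f (g x)) xs
∑-concatMap f g [] = refl
∑-concatMap f g (x ∷ xs) =
  trans (∑-++ f (g x) (concatMap g xs)) (cong (∑ f (g x) +_) (∑-concatMap f g xs))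

∑-concatMap-∷ : (f : List A → ℕ) (h : B → A) (g : B → List (List A)) (xs : List B) →
  ∑ f (concatMap (λ b → map (h b ∷_) (g b)) xs) ≡ ∑ (λ b → ∑ (λ l → f (h b ∷ l)) (g b)) xs
∑-concatMap-∷ f h g xs =
  trans (∑-concatMap f _ xs) (∑-cong xs (λ b → ∑-map f (h b ∷_) (g b)))

∑-distrib-+ : (f g : A → ℕ) (xs : List A) → ∑ (λ x → f x + g x) xs ≡ ∑ f xs + ∑ g xs
∑-distrib-+ f g [] = refl
∑-distrib-+ f g (x ∷ xs) =
  trans (cong (f x + g x +_) (∑-distrib-+ f g xs)) (+-interchange (f x) (g x) (∑ f xs) (∑ g xs))

∑-*ˡ : (c : ℕ) (f : A → ℕ) (xs : List A) → ∑ (λ x → c * f x) xs ≡ c * ∑ f xs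
∑-*ˡ c f [] = sym (*-zeroʳ c)
∑-*ˡ c f (x ∷ xs) = trans (cong (c * f x +_) (∑-*ˡ c f xs)) (sym (*-distribˡ-+ c (f x) (∑ f xs)))

∑-swap : (f : A → B → ℕ) (xs : List A) (ys : List B) →
  ∑ (λ x → ∑ (f x) ys) xs ≡ ∑ (λ y → ∑ (λ x → f x y) xs) ys
∑-swap f [] ys = sym (∑-0 ys)
∑-swap f (x ∷ xs) ys =
  trans (cong (∑ (f x) ys +_) (∑-swap f xs ys)) (sym (∑-distrib-+ (f x) _ ys))

∑-∑-0 : (xs : List A) (g : A → List B) → ∑ (λ x → ∑ (λ _ → 0) (g x)) xs ≡ 0
∑-∑-0 xs g = trans (∑-cong xs (λ x → ∑-0 (g x))) (∑-0 xs)

∑-upTo-suc : (f : ℕ → ℕ) (k : ℕ) → ∑ f (upTo (suc k)) ≡ f 0 + ∑ (f ∘ suc) (upTo k)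
∑-upTo-suc f k = cong (f 0 +_) (trans (cong (∑ f) (sym (map-upTo suc k))) (∑-map f suc (upTo k)))

⟦_⟧ : Bool → ℕ
⟦ b ⟧ = if b then 1 else 0

length-filter : (p : A → Bool) (xs : List A) → length (filter (T? ∘ p) xs) ≡ ∑ (⟦_⟧ ∘ p) xs
length-filter p [] = refl
length-filter p (x ∷ xs) with p x
... | true = cong suc (length-filter p xs)
... | false = length-filter p xs

⟦∧⟧ : ∀ a b → ⟦ a ∧ b ⟧ ≡ ⟦ a ⟧ * ⟦ b ⟧
⟦∧⟧ true b = sym (+-identityʳ ⟦ b ⟧)
⟦∧⟧ false b = refl

⟦∧⟧-* : ∀ a b c → ⟦ a ∧ b ⟧ * c ≡ ⟦ a ⟧ * (⟦ b ⟧ * c)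
⟦∧⟧-* a b c = trans (cong (_* c) (⟦∧⟧ a b)) (*-assoc ⟦ a ⟧ ⟦ b ⟧ c)

∑-⟦∧⟧ : (b : Bool) (c : A → Bool) (g : A → ℕ) (xs : List A) →
  ∑ (λ x → ⟦ b ∧ c x ⟧ * g x) xs ≡ ⟦ b ⟧ * ∑ (λ x → ⟦ c x ⟧ * g x) xs
∑-⟦∧⟧ true c g xs = sym (+-identityʳ _)
∑-⟦∧⟧ false c g xs = ∑-0 xs

∧-true⇒ˡ : ∀ {a b} → (a ∧ b) ≡ true → a ≡ true
∧-true⇒ˡ {true} e = refl

∧-true⇒ʳ : ∀ {a b} → (a ∧ b) ≡ true → b ≡ true
∧-true⇒ʳ {true} e = e

∧-cong-when : ∀ w a m x → (w ≡ true → x ≡ true → a ≡ m) → w ∧ (a ∧ x) ≡ w ∧ (m ∧ x)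
∧-cong-when false a m x f = refl
∧-cong-when true a m true f = cong (_∧ true) (f refl refl)
∧-cong-when true a m false f = trans (∧-zeroʳ a) (sym (∧-zeroʳ m))

≡true⇒T : ∀ {b} → b ≡ true → T b
≡true⇒T refl = _

T⇒≡true : ∀ {b} → T b → b ≡ true
T⇒≡true {true} _ = refl

≡ᵇ-refl : ∀ n → (n ≡ᵇ n) ≡ true
≡ᵇ-refl zero = refl
≡ᵇ-refl (suc n) = ≡ᵇ-refl n

≡ᵇ-sym : ∀ m n → (m ≡ᵇ n) ≡ (n ≡ᵇ m)
≡ᵇ-sym zero zero = refl
≡ᵇ-sym zero (suc n) = refl
≡ᵇ-sym (suc m) zero = refl
≡ᵇ-sym (suc m) (suc n) = ≡ᵇ-sym m n

≡ᵇ-true⇒≡ : ∀ m n → (m ≡ᵇ n) ≡ true → m ≡ n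
≡ᵇ-true⇒≡ m n e = ≡ᵇ⇒≡ m n (≡true⇒T e)

≢⇒≡ᵇ-false : ∀ m n → m ≢ n → (m ≡ᵇ n) ≡ false
≢⇒≡ᵇ-false m n m≢n with m ≡ᵇ n in e
... | true = ⊥-elim (m≢n (≡ᵇ-true⇒≡ m n e))
... | false = refl

+-≡ᵇ : ∀ a b c → (a + b ≡ᵇ c) ≡ ((a <ᵇ suc c) ∧ (b ≡ᵇ c ∸ a))
+-≡ᵇ zero b c = refl
+-≡ᵇ (suc a) b zero = refl
+-≡ᵇ (suc a) b (suc c) = +-≡ᵇ a b c

listEqᵇ-refl : ∀ x → listEqᵇ x x ≡ true
listEqᵇ-refl [] = refl
listEqᵇ-refl (a ∷ x) rewrite ≡ᵇ-refl a = listEqᵇ-refl x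

listEqᵇ-true⇒≡ : ∀ x y → listEqᵇ x y ≡ true → x ≡ y
listEqᵇ-true⇒≡ [] [] e = refl
listEqᵇ-true⇒≡ (a ∷ x) (b ∷ y) e =
  cong₂ _∷_ (≡ᵇ-true⇒≡ a b (∧-true⇒ˡ e)) (listEqᵇ-true⇒≡ x y (∧-true⇒ʳ e))

≡⇒listEqᵇ-true : ∀ {x y} → x ≡ y → listEqᵇ x y ≡ true
≡⇒listEqᵇ-true {x} refl = listEqᵇ-refl x

∑-select-upTo : ∀ k y (g : ℕ → ℕ) →
  ∑ (λ u → ⟦ y ≡ᵇ u ⟧ * g u) (upTo k) ≡ ⟦ y <ᵇ k ⟧ * g y
∑-select-upTo zero y g = refl
∑-select-upTo (suc k) zero g =
  trans (∑-upTo-suc (λ u → ⟦ 0 ≡ᵇ u ⟧ * g u) k)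
        (trans (cong (g 0 + 0 +_) (∑-0 (upTo k))) (+-identityʳ _))
∑-select-upTo (suc k) (suc y) g =
  trans (∑-upTo-suc (λ u → ⟦ suc y ≡ᵇ u ⟧ * g u) k) (∑-select-upTo k y (g ∘ suc))

-- Exponentwise ≤; exponent lists of different lengths are never related.
_∣ᵇ_ : Monomial → Monomial → Bool
[] ∣ᵇ [] = true
(a ∷ x) ∣ᵇ (b ∷ v) = (a <ᵇ suc b) ∧ (x ∣ᵇ v)
[] ∣ᵇ (_ ∷ _) = false
(_ ∷ _) ∣ᵇ [] = false

∑-select-divisors : ∀ v x (g : Monomial → ℕ) →
  ∑ (λ m → ⟦ listEqᵇ x m ⟧ * g m) (divisors v) ≡ ⟦ x ∣ᵇ v ⟧ * g x
∑-select-divisors [] [] g = +-identityʳ _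
∑-select-divisors [] (_ ∷ _) g = refl
∑-select-divisors (e ∷ v) [] g =
  trans (∑-concatMap-∷ _ id (λ _ → divisors v) (upTo (suc e)))
        (∑-∑-0 (upTo (suc e)) (λ _ → divisors v))
∑-select-divisors (e ∷ v) (y ∷ x) g = begin
  ∑ (λ m → ⟦ listEqᵇ (y ∷ x) m ⟧ * g m) (divisors (e ∷ v))
    ≡⟨ ∑-concatMap-∷ _ id (λ _ → divisors v) (upTo (suc e)) ⟩
  ∑ (λ a → ∑ (λ m → ⟦ (y ≡ᵇ a) ∧ listEqᵇ x m ⟧ * g (a ∷ m)) (divisors v)) (upTo (suc e))
    ≡⟨ ∑-cong (upTo (suc e)) (λ a →
         trans (∑-⟦∧⟧ (y ≡ᵇ a) (listEqᵇ x) (g ∘ (a ∷_)) (divisors v))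
               (cong (⟦ y ≡ᵇ a ⟧ *_) (∑-select-divisors v x (g ∘ (a ∷_))))) ⟩
  ∑ (λ a → ⟦ y ≡ᵇ a ⟧ * (⟦ x ∣ᵇ v ⟧ * g (a ∷ x))) (upTo (suc e))
    ≡⟨ ∑-select-upTo (suc e) y (λ a → ⟦ x ∣ᵇ v ⟧ * g (a ∷ x)) ⟩
  ⟦ y <ᵇ suc e ⟧ * (⟦ x ∣ᵇ v ⟧ * g (y ∷ x))
    ≡⟨ ⟦∧⟧-* (y <ᵇ suc e) (x ∣ᵇ v) (g (y ∷ x)) ⟨
  ⟦ (y ∷ x) ∣ᵇ (e ∷ v) ⟧ * g (y ∷ x) ∎
  where open ≡-Reasoning

InRange : ℕ → ℕ → Set
InRange k y = 1 ≤ y × y < 1 + k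

inRangeᵇ : ℕ → ℕ → Bool
inRangeᵇ k zero = false
inRangeᵇ k (suc y) = y <ᵇ k

InRange⇒inRangeᵇ : ∀ k y → InRange k y → inRangeᵇ k y ≡ true
InRange⇒inRangeᵇ k (suc y) (_ , s≤s y<k) = T⇒≡true (<⇒<ᵇ y<k)

∑-select-allRows : ∀ a k x (g : List ℕ → ℕ) →
  ∑ (λ r → ⟦ listEqᵇ r x ⟧ * g r) (allRows a k)
  ≡ ⟦ (length x ≡ᵇ a) ∧ allᵇ (inRangeᵇ k) x ⟧ * g x
∑-select-allRows zero k [] g = +-identityʳ _
∑-select-allRows zero k (_ ∷ _) g = refl
∑-select-allRows (suc a) k [] g =
  trans (∑-concatMap-∷ _ id (λ _ → allRows a k) (oneTo k)) (∑-∑-0 (oneTo k) (λ _ → allRows a k))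
∑-select-allRows (suc a) k (zero ∷ x) g =
  trans (∑-concatMap-∷ _ id (λ _ → allRows a k) (oneTo k))
        (trans (∑-map _ suc (upTo k)) (trans (∑-∑-0 (upTo k) (λ _ → allRows a k))
               (sym (cong (λ b → ⟦ b ⟧ * g (zero ∷ x)) (∧-zeroʳ (length x ≡ᵇ a))))))
∑-select-allRows (suc a) k (suc y ∷ x) g = begin
  ∑ (λ r → ⟦ listEqᵇ r (suc y ∷ x) ⟧ * g r) (allRows (suc a) k)
    ≡⟨ ∑-concatMap-∷ _ id (λ _ → allRows a k) (oneTo k) ⟩
  ∑ (λ v → ∑ (λ r → ⟦ listEqᵇ (v ∷ r) (suc y ∷ x) ⟧ * g (v ∷ r)) (allRows a k))
    (map suc (upTo k))
    ≡⟨ ∑-map _ suc (upTo k) ⟩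
  ∑ (λ u → ∑ (λ r → ⟦ (u ≡ᵇ y) ∧ listEqᵇ r x ⟧ * g (suc u ∷ r)) (allRows a k)) (upTo k)
    ≡⟨ ∑-cong (upTo k) (λ u →
         trans (∑-⟦∧⟧ (u ≡ᵇ y) (λ r → listEqᵇ r x) (g ∘ (suc u ∷_)) (allRows a k))
               (cong₂ (λ b n → ⟦ b ⟧ * n) (≡ᵇ-sym u y)
                      (∑-select-allRows a k x (g ∘ (suc u ∷_))))) ⟩
  ∑ (λ u → ⟦ y ≡ᵇ u ⟧ * (⟦ R ⟧ * g (suc u ∷ x))) (upTo k)
    ≡⟨ ∑-select-upTo k y (λ u → ⟦ R ⟧ * g (suc u ∷ x)) ⟩
  ⟦ y <ᵇ k ⟧ * (⟦ R ⟧ * g (suc y ∷ x))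
    ≡⟨ ⟦∧⟧-* (y <ᵇ k) R (g (suc y ∷ x)) ⟨
  ⟦ (y <ᵇ k) ∧ ((length x ≡ᵇ a) ∧ allᵇ (inRangeᵇ k) x) ⟧ * g (suc y ∷ x)
    ≡⟨ cong (λ b → ⟦ b ⟧ * g (suc y ∷ x)) (∧-swapˡ (y <ᵇ k) (length x ≡ᵇ a) _) ⟩
  ⟦ (length x ≡ᵇ a) ∧ ((y <ᵇ k) ∧ allᵇ (inRangeᵇ k) x) ⟧ * g (suc y ∷ x) ∎
  where
  open ≡-Reasoning
  R = (length x ≡ᵇ a) ∧ allᵇ (inRangeᵇ k) x

∑-select-compositionsF : ∀ f n x (g : List ℕ → ℕ) → n ≤ f → All (0 <_) x →
  ∑ (λ β → ⟦ listEqᵇ x β ⟧ * g β) (compositionsF f n) ≡ ⟦ sum x ≡ᵇ n ⟧ * g x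
∑-select-compositionsF f zero [] g _ _ = +-identityʳ _
∑-select-compositionsF f zero (suc j ∷ x) g _ _ = refl
∑-select-compositionsF f n (zero ∷ x) g _ (() ∷ _)
∑-select-compositionsF zero (suc n) x g () _
∑-select-compositionsF (suc f) (suc n) [] g _ _ =
  trans (∑-concatMap-∷ _ suc (λ k → compositionsF f (n ∸ k)) (upTo (suc n)))
        (∑-∑-0 (upTo (suc n)) (λ k → compositionsF f (n ∸ k)))
∑-select-compositionsF (suc f) (suc n) (suc j ∷ x) g (s≤s n≤f) (_ ∷ x>0) = begin
  ∑ (λ β → ⟦ listEqᵇ (suc j ∷ x) β ⟧ * g β) (compositionsF (suc f) (suc n))
    ≡⟨ ∑-concatMap-∷ _ suc (λ k → compositionsF f (n ∸ k)) (upTo (suc n)) ⟩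
  ∑ (λ k → ∑ (λ β → ⟦ (j ≡ᵇ k) ∧ listEqᵇ x β ⟧ * g (suc k ∷ β)) (compositionsF f (n ∸ k)))
    (upTo (suc n))
    ≡⟨ ∑-cong (upTo (suc n)) (λ k →
         trans (∑-⟦∧⟧ (j ≡ᵇ k) (listEqᵇ x) (g ∘ (suc k ∷_)) (compositionsF f (n ∸ k)))
               (cong (⟦ j ≡ᵇ k ⟧ *_)
                     (∑-select-compositionsF f (n ∸ k) x (g ∘ (suc k ∷_))
                                              (≤-trans (m∸n≤m n k) n≤f) x>0))) ⟩
  ∑ (λ k → ⟦ j ≡ᵇ k ⟧ * (⟦ sum x ≡ᵇ n ∸ k ⟧ * g (suc k ∷ x))) (upTo (suc n))
    ≡⟨ ∑-select-upTo (suc n) j (λ k → ⟦ sum x ≡ᵇ n ∸ k ⟧ * g (suc k ∷ x)) ⟩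
  ⟦ j <ᵇ suc n ⟧ * (⟦ sum x ≡ᵇ n ∸ j ⟧ * g (suc j ∷ x))
    ≡⟨ ⟦∧⟧-* (j <ᵇ suc n) (sum x ≡ᵇ n ∸ j) (g (suc j ∷ x)) ⟨
  ⟦ (j <ᵇ suc n) ∧ (sum x ≡ᵇ n ∸ j) ⟧ * g (suc j ∷ x)
    ≡⟨ cong (λ b → ⟦ b ⟧ * g (suc j ∷ x)) (+-≡ᵇ j (sum x) n) ⟨
  ⟦ j + sum x ≡ᵇ n ⟧ * g (suc j ∷ x) ∎
  where open ≡-Reasoning

-- Weakly increasing rows and their contents

contentFrom : ℕ → ℕ → List ℕ → List ℕ
contentFrom lo zero s = []
contentFrom lo (suc k) s = countᵇ lo s ∷ contentFrom (suc lo) k s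

rowFrom : ℕ → List ℕ → List ℕ
rowFrom lo [] = []
rowFrom lo (c ∷ m) = replicate c lo ++ rowFrom (suc lo) m

-- The monomial x_{w₁} x_{w₂} ⋯ of a word w in the letters 1, …, k.
content : ℕ → List ℕ → Monomial
content = contentFrom 1

length-contentFrom : ∀ lo k s → length (contentFrom lo k s) ≡ k
length-contentFrom lo zero s = refl
length-contentFrom lo (suc k) s = cong suc (length-contentFrom (suc lo) k s)

length-rowFrom : ∀ lo m → length (rowFrom lo m) ≡ sum m
length-rowFrom lo [] = refl
length-rowFrom lo (c ∷ m) =
  trans (length-++ (replicate c lo)) (cong₂ _+_ (length-replicate c) (length-rowFrom (suc lo) m))

countᵇ-hit : ∀ x r → countᵇ x (x ∷ r) ≡ suc (countᵇ x r)
countᵇ-hit x r rewrite ≡ᵇ-refl x = refl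

countᵇ-miss : ∀ x y r → x ≢ y → countᵇ x (y ∷ r) ≡ countᵇ x r
countᵇ-miss x y r x≢y rewrite ≢⇒≡ᵇ-false x y x≢y = refl

countᵇ-++ : ∀ j r s → countᵇ j (r ++ s) ≡ countᵇ j r + countᵇ j s
countᵇ-++ j [] s = refl
countᵇ-++ j (a ∷ r) s with j ≡ᵇ a
... | true = cong suc (countᵇ-++ j r s)
... | false = countᵇ-++ j r s

countᵇ-replicate : ∀ lo c s → countᵇ lo (replicate c lo ++ s) ≡ c + countᵇ lo s
countᵇ-replicate lo zero s = refl
countᵇ-replicate lo (suc c) s =
  trans (countᵇ-hit lo (replicate c lo ++ s)) (cong suc (countᵇ-replicate lo c s))

countᵇ-below : ∀ j s → All (j <_) s → countᵇ j s ≡ 0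
countᵇ-below j [] _ = refl
countᵇ-below j (z ∷ s) (j<z ∷ j<s) = trans (countᵇ-miss j z s (<⇒≢ j<z)) (countᵇ-below j s j<s)

contentFrom-∷-below : ∀ lo k x s → x < lo → contentFrom lo k (x ∷ s) ≡ contentFrom lo k s
contentFrom-∷-below lo zero x s x<lo = refl
contentFrom-∷-below lo (suc k) x s x<lo =
  cong₂ _∷_ (countᵇ-miss lo x s (≢-sym (<⇒≢ x<lo)))
            (contentFrom-∷-below (suc lo) k x s (m<n⇒m<1+n x<lo))

contentFrom-replicate : ∀ lo k c s →
  contentFrom (suc lo) k (replicate c lo ++ s) ≡ contentFrom (suc lo) k s
contentFrom-replicate lo k zero s = refl
contentFrom-replicate lo k (suc c) s =
  trans (contentFrom-∷-below (suc lo) k lo _ ≤-refl) (contentFrom-replicate lo k c s)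

contentFrom-++ : ∀ lo k r s →
  contentFrom lo k (r ++ s) ≡ zipWith _+_ (contentFrom lo k r) (contentFrom lo k s)
contentFrom-++ lo zero r s = refl
contentFrom-++ lo (suc k) r s = cong₂ _∷_ (countᵇ-++ lo r s) (contentFrom-++ (suc lo) k r s)

rowFrom-bounds : ∀ lo m → All (λ y → lo ≤ y × y < lo + length m) (rowFrom lo m)
rowFrom-bounds lo [] = []
rowFrom-bounds lo (c ∷ m) = ++⁺ (replicate-bounds c) (All.map weaken (rowFrom-bounds (suc lo) m))
  where
  lo<lo+1+m : lo < lo + suc (length m)
  lo<lo+1+m = subst (lo <_) (sym (+-suc lo (length m))) (s≤s (m≤m+n lo (length m)))
  replicate-bounds : ∀ c → All (λ y → lo ≤ y × y < lo + suc (length m)) (replicate c lo)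
  replicate-bounds zero = []
  replicate-bounds (suc c) = (≤-refl , lo<lo+1+m) ∷ replicate-bounds c
  weaken : ∀ {y} → suc lo ≤ y × y < suc lo + length m → lo ≤ y × y < lo + suc (length m)
  weaken {y} (lo<y , y<) = <⇒≤ lo<y , subst (y <_) (sym (+-suc lo (length m))) y<

contentFrom-rowFrom : ∀ lo m → contentFrom lo (length m) (rowFrom lo m) ≡ m
contentFrom-rowFrom lo [] = refl
contentFrom-rowFrom lo (c ∷ m) =
  cong₂ _∷_ count-lo (trans (contentFrom-replicate lo (length m) c _) (contentFrom-rowFrom (suc lo) m))
  where
  count-lo : countᵇ lo (replicate c lo ++ rowFrom (suc lo) m) ≡ c
  count-lo = begin
    countᵇ lo (replicate c lo ++ rowFrom (suc lo) m)
      ≡⟨ countᵇ-replicate lo c _ ⟩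
    c + countᵇ lo (rowFrom (suc lo) m)
      ≡⟨ cong (c +_) (countᵇ-below lo _ (All.map proj₁ (rowFrom-bounds (suc lo) m))) ⟩
    c + 0
      ≡⟨ +-identityʳ c ⟩
    c ∎
    where open ≡-Reasoning

weaklyIncr-head≤ : ∀ x l → weaklyIncr (x ∷ l) ≡ true → All (x ≤_) (x ∷ l)
weaklyIncr-head≤ x [] w = ≤-refl ∷ []
weaklyIncr-head≤ x (y ∷ l) w =
  ≤-refl ∷ All.map (≤-trans (≤ᵇ⇒≤ x y (≡true⇒T (∧-true⇒ˡ w))))
                   (weaklyIncr-head≤ y l (∧-true⇒ʳ w))

weaklyIncr-tail : ∀ x l → weaklyIncr (x ∷ l) ≡ true → weaklyIncr l ≡ true
weaklyIncr-tail x [] w = refl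
weaklyIncr-tail x (y ∷ l) w = ∧-true⇒ʳ w

weaklyIncr-∷ : ∀ x l → weaklyIncr l ≡ true → All (x ≤_) l → weaklyIncr (x ∷ l) ≡ true
weaklyIncr-∷ x [] w _ = refl
weaklyIncr-∷ x (y ∷ l) w (x≤y ∷ _) rewrite T⇒≡true (≤⇒≤ᵇ x≤y) = w

weaklyIncr-rowFrom : ∀ lo m → weaklyIncr (rowFrom lo m) ≡ true
weaklyIncr-rowFrom lo [] = refl
weaklyIncr-rowFrom lo (c ∷ m) = go c
  where
  lo≤ : ∀ c → All (lo ≤_) (replicate c lo ++ rowFrom (suc lo) m)
  lo≤ zero = All.map (<⇒≤ ∘ proj₁) (rowFrom-bounds (suc lo) m)
  lo≤ (suc c) = ≤-refl ∷ lo≤ c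
  go : ∀ c → weaklyIncr (replicate c lo ++ rowFrom (suc lo) m) ≡ true
  go zero = weaklyIncr-rowFrom (suc lo) m
  go (suc c) = weaklyIncr-∷ lo _ (go c) (lo≤ c)

rowFrom-contentFrom : ∀ k lo r → weaklyIncr r ≡ true → All (λ y → lo ≤ y × y < lo + k) r →
  r ≡ rowFrom lo (contentFrom lo k r)
rowFrom-contentFrom-suc : ∀ k lo r → weaklyIncr r ≡ true →
  All (λ y → lo ≤ y × y < lo + suc k) r →
  r ≡ rowFrom lo (contentFrom lo (suc k) r)
rowFrom-contentFrom-∷ : ∀ k lo x r → weaklyIncr (x ∷ r) ≡ true →
  All (λ y → lo ≤ y × y < lo + suc k) (x ∷ r) → Dec (x ≡ lo) →
  x ∷ r ≡ rowFrom lo (contentFrom lo (suc k) (x ∷ r))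

rowFrom-contentFrom zero lo [] _ _ = refl
rowFrom-contentFrom zero lo (x ∷ r) _ ((lo≤x , x<lo+0) ∷ _) =
  ⊥-elim (<⇒≱ (subst (x <_) (+-identityʳ lo) x<lo+0) lo≤x)
rowFrom-contentFrom (suc k) = rowFrom-contentFrom-suc k

rowFrom-contentFrom-suc k lo [] _ _ = rowFrom-contentFrom k (suc lo) [] refl []
rowFrom-contentFrom-suc k lo (x ∷ r) w bounds = rowFrom-contentFrom-∷ k lo x r w bounds (x ≟ lo)

rowFrom-contentFrom-∷ k lo x r w (_ ∷ r-bounds) (yes refl) = begin
  x ∷ r
    ≡⟨ cong (x ∷_) (rowFrom-contentFrom-suc k x r (weaklyIncr-tail x r w) r-bounds) ⟩
  x ∷ (replicate (countᵇ x r) x ++ rowFrom (suc x) (contentFrom (suc x) k r))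
    ≡⟨ cong (λ c → x ∷ (replicate (countᵇ x r) x ++ rowFrom (suc x) c))
            (contentFrom-∷-below (suc x) k x r ≤-refl) ⟨
  x ∷ (replicate (countᵇ x r) x ++ rowFrom (suc x) (contentFrom (suc x) k (x ∷ r)))
    ≡⟨ cong (λ c → replicate c x ++ rowFrom (suc x) (contentFrom (suc x) k (x ∷ r)))
            (countᵇ-hit x r) ⟨
  rowFrom x (contentFrom x (suc k) (x ∷ r)) ∎
  where open ≡-Reasoning
rowFrom-contentFrom-∷ k lo x r w bounds@((lo≤x , _) ∷ _) (no x≢lo) = begin
  x ∷ r
    ≡⟨ rowFrom-contentFrom k (suc lo) (x ∷ r) w
                           (All.zipWith shift (weaklyIncr-head≤ x r w , bounds)) ⟩
  rowFrom (suc lo) (contentFrom (suc lo) k (x ∷ r))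
    ≡⟨ cong (λ c → replicate c lo ++ rowFrom (suc lo) (contentFrom (suc lo) k (x ∷ r)))
            (countᵇ-below lo (x ∷ r) (All.map (<-≤-trans lo<x) (weaklyIncr-head≤ x r w))) ⟨
  rowFrom lo (contentFrom lo (suc k) (x ∷ r)) ∎
  where
  open ≡-Reasoning
  lo<x : lo < x
  lo<x = ≤∧≢⇒< lo≤x (≢-sym x≢lo)
  shift : ∀ {z} → x ≤ z × (lo ≤ z × z < lo + suc k) → suc lo ≤ z × z < suc lo + k
  shift {z} (x≤z , _ , z<) = <-≤-trans lo<x x≤z , subst (z <_) (+-suc lo k) z<

weaklyIncr∧content≡ᵇ : ∀ k r m → length m ≡ k → All (InRange k) r →
  (weaklyIncr r ∧ listEqᵇ (content k r) m) ≡ listEqᵇ r (rowFrom 1 m)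
weaklyIncr∧content≡ᵇ k r m refl r-range = ⇔→≡ {z = true} (mk⇔ to from)
  where
  to : (weaklyIncr r ∧ listEqᵇ (content k r) m) ≡ true → listEqᵇ r (rowFrom 1 m) ≡ true
  to e = ≡⇒listEqᵇ-true
    (trans (rowFrom-contentFrom k 1 r (∧-true⇒ˡ e) r-range)
           (cong (rowFrom 1) (listEqᵇ-true⇒≡ (content k r) m (∧-true⇒ʳ {weaklyIncr r} e))))
  from : listEqᵇ r (rowFrom 1 m) ≡ true → (weaklyIncr r ∧ listEqᵇ (content k r) m) ≡ true
  from e with listEqᵇ-true⇒≡ r (rowFrom 1 m) e
  ... | refl = cong₂ _∧_ (weaklyIncr-rowFrom 1 m)
                         (≡⇒listEqᵇ-true {content (length m) (rowFrom 1 m)} (contentFrom-rowFrom 1 m))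

All⇒allᵇ : {p : A → Bool} {l : List A} → All (λ y → p y ≡ true) l → allᵇ p l ≡ true
All⇒allᵇ [] = refl
All⇒allᵇ (e ∷ es) rewrite e = All⇒allᵇ es

All-concatMap : {P : B → Set} {Q : A → Set} (g : A → List B) {xs : List A} →
  All Q xs → (∀ {x} → Q x → All P (g x)) → All P (concatMap g xs)
All-concatMap g qs f = concat⁺ (map⁺ (All.map f qs))

length-divisors : ∀ v → All (λ m → length m ≡ length v) (divisors v)
length-divisors [] = refl ∷ []
length-divisors (e ∷ v) =
  All-concatMap _ (all-upTo (suc e)) (λ _ → map⁺ (All.map (cong suc) (length-divisors v)))

InRange-oneTo : ∀ k → All (InRange k) (oneTo k)
InRange-oneTo k = map⁺ (All.map (λ y<k → s≤s z≤n , s≤s y<k) (all-upTo k))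

allRows-shape : ∀ a k → All (λ r → length r ≡ a × All (InRange k) r) (allRows a k)
allRows-shape zero k = (refl , []) ∷ []
allRows-shape (suc a) k = All-concatMap _ (InRange-oneTo k)
  (λ v-range → map⁺ (All.map (λ (len , range) → cong suc len , v-range ∷ range)
                             (allRows-shape a k)))

firstRowWeight : Monomial → (Monomial → ℕ) → List ℕ → ℕ
firstRowWeight v Ψ r = ⟦ weaklyIncr r ∧ (content (length v) r ∣ᵇ v) ⟧ * Ψ (content (length v) r)

-- Weakly increasing rows of length a in [1..k] correspond to their contents,
-- the exponent vectors of length k and degree a.
∑-rows≡∑-divisors : ∀ v a (Ψ : Monomial → ℕ) →
  ∑ (firstRowWeight v Ψ) (allRows a (length v)) ≡ ∑ (λ m → ⟦ sum m ≡ᵇ a ⟧ * Ψ m) (divisors v)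
∑-rows≡∑-divisors v a Ψ = begin
  ∑ (firstRowWeight v Ψ) rows
    ≡⟨ ∑-cong rows expand ⟩
  ∑ (λ r → ∑ (λ m → ⟦ weaklyIncr r ∧ listEqᵇ (c r) m ⟧ * Ψ m) (divisors v)) rows
    ≡⟨ ∑-swap (λ r m → ⟦ weaklyIncr r ∧ listEqᵇ (c r) m ⟧ * Ψ m) rows (divisors v) ⟩
  ∑ (λ m → ∑ (λ r → ⟦ weaklyIncr r ∧ listEqᵇ (c r) m ⟧ * Ψ m) rows) (divisors v)
    ≡⟨ ∑-cong-All (length-divisors v) count-rows ⟩
  ∑ (λ m → ⟦ sum m ≡ᵇ a ⟧ * Ψ m) (divisors v) ∎
  where
  open ≡-Reasoning
  k = length v
  c = content k
  rows = allRows a k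
  expand : ∀ r → ⟦ weaklyIncr r ∧ (c r ∣ᵇ v) ⟧ * Ψ (c r)
               ≡ ∑ (λ m → ⟦ weaklyIncr r ∧ listEqᵇ (c r) m ⟧ * Ψ m) (divisors v)
  expand r = begin
    ⟦ weaklyIncr r ∧ (c r ∣ᵇ v) ⟧ * Ψ (c r)
      ≡⟨ ⟦∧⟧-* (weaklyIncr r) _ _ ⟩
    ⟦ weaklyIncr r ⟧ * (⟦ c r ∣ᵇ v ⟧ * Ψ (c r))
      ≡⟨ cong (⟦ weaklyIncr r ⟧ *_) (∑-select-divisors v (c r) Ψ) ⟨
    ⟦ weaklyIncr r ⟧ * ∑ (λ m → ⟦ listEqᵇ (c r) m ⟧ * Ψ m) (divisors v)
      ≡⟨ ∑-⟦∧⟧ (weaklyIncr r) (listEqᵇ (c r)) Ψ (divisors v) ⟨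
    ∑ (λ m → ⟦ weaklyIncr r ∧ listEqᵇ (c r) m ⟧ * Ψ m) (divisors v) ∎
  count-rows : ∀ m → length m ≡ k →
    ∑ (λ r → ⟦ weaklyIncr r ∧ listEqᵇ (c r) m ⟧ * Ψ m) rows ≡ ⟦ sum m ≡ᵇ a ⟧ * Ψ m
  count-rows m lm = begin
    ∑ (λ r → ⟦ weaklyIncr r ∧ listEqᵇ (c r) m ⟧ * Ψ m) rows
      ≡⟨ ∑-cong-All (allRows-shape a k) (λ r (_ , range) →
           cong (λ b → ⟦ b ⟧ * Ψ m) (weaklyIncr∧content≡ᵇ k r m lm range)) ⟩
    ∑ (λ r → ⟦ listEqᵇ r (rowFrom 1 m) ⟧ * Ψ m) rows
      ≡⟨ ∑-select-allRows a k (rowFrom 1 m) (λ _ → Ψ m) ⟩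
    ⟦ (length (rowFrom 1 m) ≡ᵇ a) ∧ allᵇ (inRangeᵇ k) (rowFrom 1 m) ⟧ * Ψ m
      ≡⟨ cong₂ (λ l b → ⟦ (l ≡ᵇ a) ∧ b ⟧ * Ψ m) (length-rowFrom 1 m) in-range ⟩
    ⟦ (sum m ≡ᵇ a) ∧ true ⟧ * Ψ m
      ≡⟨ cong (λ b → ⟦ b ⟧ * Ψ m) (∧-identityʳ (sum m ≡ᵇ a)) ⟩
    ⟦ sum m ≡ᵇ a ⟧ * Ψ m ∎
    where
    in-range : allᵇ (inRangeᵇ k) (rowFrom 1 m) ≡ true
    in-range = All⇒allᵇ (All.map (InRange⇒inRangeᵇ k _)
                                 (subst (λ n → All (InRange n) (rowFrom 1 m)) lm (rowFrom-bounds 1 m)))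

minSupp-0∷ : ∀ w → minSupp (zero ∷ w) ≡ Maybe.map suc (minSupp w)
minSupp-0∷ w with minSupp w
... | just i = refl
... | nothing = refl

minSupp-contentFrom-[] : ∀ lo k → minSupp (contentFrom lo k []) ≡ nothing
minSupp-contentFrom-[] lo zero = refl
minSupp-contentFrom-[] lo (suc k) =
  trans (minSupp-0∷ (contentFrom (suc lo) k [])) (cong (Maybe.map suc) (minSupp-contentFrom-[] (suc lo) k))

minSupp-contentFrom : ∀ k lo i s → All (lo + i ≤_) s → i < k → 0 < countᵇ (lo + i) s →
  minSupp (contentFrom lo k s) ≡ just i
minSupp-contentFrom (suc k) lo zero s _ _ occurs with countᵇ lo s in e
... | zero = ⊥-elim (<-irrefl (sym e) (subst (λ j → 0 < countᵇ j s) (+-identityʳ lo) occurs))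
... | suc _ = refl
minSupp-contentFrom (suc k) lo (suc i) s s≥ (s≤s i<k) occurs = begin
  minSupp (countᵇ lo s ∷ contentFrom (suc lo) k s)
    ≡⟨ cong (λ c → minSupp (c ∷ contentFrom (suc lo) k s))
            (countᵇ-below lo s (All.map (<-≤-trans lo<lo+1+i) s≥)) ⟩
  minSupp (0 ∷ contentFrom (suc lo) k s)
    ≡⟨ minSupp-0∷ (contentFrom (suc lo) k s) ⟩
  Maybe.map suc (minSupp (contentFrom (suc lo) k s))
    ≡⟨ cong (Maybe.map suc)
            (minSupp-contentFrom k (suc lo) i s (All.map (≤-trans (≤-reflexive (sym (+-suc lo i)))) s≥)
                                 i<k (subst (λ j → 0 < countᵇ j s) (+-suc lo i) occurs)) ⟩
  just (suc i) ∎
  where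
  open ≡-Reasoning
  lo<lo+1+i : lo < lo + suc i
  lo<lo+1+i = subst (lo <_) (sym (+-suc lo i)) (s≤s (m≤m+n lo i))

-- Index 0 of a content vector counts the letter 1, hence the shift by one.
minSupp-content : ∀ k i s → All (suc i ≤_) s → i < k → minSupp (content k (suc i ∷ s)) ≡ just i
minSupp-content k i s s≥ i<k =
  minSupp-contentFrom k 1 i (suc i ∷ s) (≤-refl ∷ s≥) i<k
                      (subst (0 <_) (sym (countᵇ-hit (suc i) s)) z<s)

strictlyIncr-∷ : ∀ x l → strictlyIncr (x ∷ l) ≡ (just x <∞ head l) ∧ strictlyIncr l
strictlyIncr-∷ x [] = refl
strictlyIncr-∷ x (y ∷ l) = refl

<∞⇒≤ : ∀ y m → (just y <∞ m) ≡ true → MaybeAll.All (y ≤_) m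
<∞⇒≤ y nothing _ = nothing
<∞⇒≤ y (just z) y<z = just (<⇒≤ (<ᵇ⇒< y z (≡true⇒T y<z)))

<∞-suc : ∀ i m → (just (suc i) <∞ Maybe.map suc m) ≡ (just i <∞ m)
<∞-suc i nothing = refl
<∞-suc i (just j) = refl

IsFilling : ℕ → List (List ℕ) → Set
IsFilling k T = All (λ r → 0 < length r × All (InRange k) r) T

isImmaculate-∷ : ∀ x r T →
  isImmaculate ((x ∷ r) ∷ T)
  ≡ weaklyIncr (x ∷ r) ∧ ((just x <∞ head (firstColumn T)) ∧ isImmaculate T)
isImmaculate-∷ x r T = begin
  strictlyIncr (x ∷ firstColumn T) ∧ (w ∧ c)
    ≡⟨ cong (_∧ (w ∧ c)) (strictlyIncr-∷ x (firstColumn T)) ⟩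
  (a ∧ s) ∧ (w ∧ c)  ≡⟨ ∧-interchange a s w c ⟩
  (a ∧ w) ∧ (s ∧ c)  ≡⟨ cong (_∧ (s ∧ c)) (∧-comm a w) ⟩
  (w ∧ a) ∧ (s ∧ c)  ≡⟨ ∧-assoc w a (s ∧ c) ⟩
  w ∧ (a ∧ (s ∧ c)) ∎
  where
  open ≡-Reasoning
  a = just x <∞ head (firstColumn T)
  s = strictlyIncr (firstColumn T)
  w = weaklyIncr (x ∷ r)
  c = allᵇ weaklyIncr T

immaculate-≥-head : ∀ {k} T → IsFilling k T → isImmaculate T ≡ true →
  ∀ h → MaybeAll.All (h ≤_) (head (firstColumn T)) → All (h ≤_) (concat T)
immaculate-≥-head [] _ _ h _ = []
immaculate-≥-head ((y ∷ r) ∷ T) (_ ∷ T-filling) imm h (just h≤y) =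
  ++⁺ (All.map (≤-trans h≤y) (weaklyIncr-head≤ y r (∧-true⇒ˡ imm′)))
      (All.map (≤-trans h≤y)
               (immaculate-≥-head T T-filling (∧-true⇒ʳ {just y <∞ head (firstColumn T)} rest)
                                  y (<∞⇒≤ y _ (∧-true⇒ˡ rest))))
  where
  imm′ = trans (sym (isImmaculate-∷ y r T)) imm
  rest = ∧-true⇒ʳ {weaklyIncr (y ∷ r)} imm′

head-firstColumn : ∀ k T → IsFilling k T → isImmaculate T ≡ true →
  head (firstColumn T) ≡ Maybe.map suc (minSupp (content k (concat T)))
head-firstColumn k [] _ _ = sym (cong (Maybe.map suc) (minSupp-contentFrom-[] 1 k))
head-firstColumn k ((zero ∷ r) ∷ T) ((_ , ((() , _) ∷ _)) ∷ _) _
head-firstColumn k ((suc i ∷ r) ∷ T) T-filling@((_ , ((_ , s≤s i<k) ∷ _)) ∷ _) imm =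
  sym (cong (Maybe.map suc) (minSupp-content k i (r ++ concat T) entries≥ i<k))
  where
  entries≥ : All (suc i ≤_) (r ++ concat T)
  entries≥ = All.tail (immaculate-≥-head ((suc i ∷ r) ∷ T) T-filling imm (suc i) (just ≤-refl))

-- Removing the first row

counts≡contentFrom : ∀ s n lo (g : ℕ → ℕ) → (∀ i → suc (g i) ≡ lo + i) →
  map (λ j → countᵇ j s) (map suc (applyUpTo g n)) ≡ contentFrom lo n s
counts≡contentFrom s zero lo g g≡ = refl
counts≡contentFrom s (suc n) lo g g≡ =
  cong₂ _∷_ (cong (λ j → countᵇ j s) (trans (g≡ 0) (+-identityʳ lo)))
            (counts≡contentFrom s n (suc lo) (g ∘ suc) (λ i → trans (g≡ (suc i)) (+-suc lo i)))

hasContent-content : ∀ u T → hasContent u T ≡ listEqᵇ (content (length u) (concat T)) u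
hasContent-content u T =
  cong (λ c → listEqᵇ c u) (counts≡contentFrom (concat T) (length u) 1 id (λ _ → refl))

contentFrom-[]≡ᵇ : ∀ lo v → listEqᵇ (contentFrom lo (length v) []) v ≡ (sum v ≡ᵇ 0)
contentFrom-[]≡ᵇ lo [] = refl
contentFrom-[]≡ᵇ lo (zero ∷ v) = contentFrom-[]≡ᵇ (suc lo) v
contentFrom-[]≡ᵇ lo (suc e ∷ v) = refl

length-quot : ∀ v m → length m ≡ length v → length (quot v m) ≡ length m
length-quot [] [] _ = refl
length-quot (x ∷ v) (y ∷ m) e = cong suc (length-quot v m (suc-injective e))

+≡ᵇ⇔∣ᵇ∧quot : ∀ p q v → length p ≡ length v → length q ≡ length v →
  listEqᵇ (zipWith _+_ p q) v ≡ (p ∣ᵇ v) ∧ listEqᵇ q (quot v p)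
+≡ᵇ⇔∣ᵇ∧quot [] [] [] _ _ = refl
+≡ᵇ⇔∣ᵇ∧quot (a ∷ p) (b ∷ q) (c ∷ v) lp lq =
  trans (cong₂ _∧_ (+-≡ᵇ a b c) (+≡ᵇ⇔∣ᵇ∧quot p q v (suc-injective lp) (suc-injective lq)))
        (∧-interchange (a <ᵇ suc c) (b ≡ᵇ c ∸ a) (p ∣ᵇ v) (listEqᵇ q (quot v p)))

length-quot-content : ∀ v r → length (quot v (content (length v) r)) ≡ length v
length-quot-content v r =
  trans (length-quot v _ (length-contentFrom 1 (length v) r)) (length-contentFrom 1 (length v) r)

hasContent-∷ : ∀ v r T → let m = content (length v) r in
  hasContent v (r ∷ T) ≡ (m ∣ᵇ v) ∧ hasContent (quot v m) T
hasContent-∷ v r T = begin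
  hasContent v (r ∷ T)
    ≡⟨ hasContent-content v (r ∷ T) ⟩
  listEqᵇ (content k (r ++ concat T)) v
    ≡⟨ cong (λ c → listEqᵇ c v) (contentFrom-++ 1 k r (concat T)) ⟩
  listEqᵇ (zipWith _+_ m (content k (concat T))) v
    ≡⟨ +≡ᵇ⇔∣ᵇ∧quot m _ v (length-contentFrom 1 k r) (length-contentFrom 1 k (concat T)) ⟩
  (m ∣ᵇ v) ∧ listEqᵇ (content k (concat T)) (quot v m)
    ≡⟨ cong (λ n → (m ∣ᵇ v) ∧ listEqᵇ (content n (concat T)) (quot v m))
            (length-quot-content v r) ⟨
  (m ∣ᵇ v) ∧ listEqᵇ (content (length (quot v m)) (concat T)) (quot v m)
    ≡⟨ cong ((m ∣ᵇ v) ∧_) (hasContent-content (quot v m) T) ⟨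
  (m ∣ᵇ v) ∧ hasContent (quot v m) T ∎
  where
  open ≡-Reasoning
  k = length v
  m = content k r

allFillings-shape : ∀ α k → All (0 <_) α → All (IsFilling k) (allFillings α k)
allFillings-shape [] k _ = [] ∷ []
allFillings-shape (a ∷ α) k (a>0 ∷ α>0) = All-concatMap _ (allRows-shape a k)
  (λ (len , range) → map⁺ (All.map (λ T-filling → (subst (0 <_) (sym len) a>0 , range) ∷ T-filling)
                                   (allFillings-shape α k α>0)))

-- The number of completions of a first row of content m to a tableau counted by K (a ∷ α) v.
completions : List ℕ → Monomial → Monomial → ℕ
completions α v m = ⟦ minSupp m <∞ minSupp (quot v m) ⟧ * K α (quot v m)

-- Splitting off the first row: the immaculacy condition on the first column
-- becomes  min Supp m < min Supp (v / m)  for the content m of that row.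
∑-first-row : ∀ α v r → All (0 <_) α → 0 < length r → All (InRange (length v)) r →
  ∑ (λ T → ⟦ isImmaculate (r ∷ T) ∧ hasContent v (r ∷ T) ⟧) (allFillings α (length v))
  ≡ firstRowWeight v (completions α v) r
∑-first-row α v (zero ∷ r) _ _ ((() , _) ∷ _)
∑-first-row α v (suc i ∷ r) α>0 _ ((_ , s≤s i<k) ∷ _) = begin
  ∑ (λ T → ⟦ isImmaculate (row ∷ T) ∧ hasContent v (row ∷ T) ⟧) fillings
    ≡⟨ ∑-cong-All (allFillings-shape α k α>0) split ⟩
  ∑ (λ T → ⟦ w ∧ l ⟧ * (⟦ M ⟧ * ⟦ isImmaculate T ∧ hasContent q T ⟧)) fillings
    ≡⟨ ∑-*ˡ ⟦ w ∧ l ⟧ _ fillings ⟩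
  ⟦ w ∧ l ⟧ * ∑ (λ T → ⟦ M ⟧ * ⟦ isImmaculate T ∧ hasContent q T ⟧) fillings
    ≡⟨ cong (⟦ w ∧ l ⟧ *_) (∑-*ˡ ⟦ M ⟧ _ fillings) ⟩
  ⟦ w ∧ l ⟧ * (⟦ M ⟧ * ∑ (λ T → ⟦ isImmaculate T ∧ hasContent q T ⟧) fillings)
    ≡⟨ cong (λ n → ⟦ w ∧ l ⟧ * (⟦ M ⟧ * n)) count-completions ⟩
  ⟦ w ∧ l ⟧ * completions α v m ∎
  where
  open ≡-Reasoning
  k = length v
  row = suc i ∷ r
  m = content k row
  q = quot v m
  w = weaklyIncr row
  l = m ∣ᵇ v
  M = minSupp m <∞ minSupp q
  fillings = allFillings α k

  length-q : length q ≡ k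
  length-q = length-quot-content v row

  count-completions : ∑ (λ T → ⟦ isImmaculate T ∧ hasContent q T ⟧) fillings ≡ K α q
  count-completions = begin
    ∑ (⟦_⟧ ∘ P) (allFillings α k)
      ≡⟨ cong (λ n → ∑ (⟦_⟧ ∘ P) (allFillings α n)) length-q ⟨
    ∑ (⟦_⟧ ∘ P) (allFillings α (length q))
      ≡⟨ length-filter P (allFillings α (length q)) ⟨
    K α q ∎
    where
    P : List (List ℕ) → Bool
    P T = isImmaculate T ∧ hasContent q T

  head-condition : ∀ T → IsFilling k T → w ≡ true → (isImmaculate T ∧ hasContent q T) ≡ true →
    (just (suc i) <∞ head (firstColumn T)) ≡ M
  head-condition T T-filling w-true IE = begin
    just (suc i) <∞ head (firstColumn T)
      ≡⟨ cong (just (suc i) <∞_) (head-firstColumn k T T-filling (∧-true⇒ˡ IE)) ⟩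
    just (suc i) <∞ Maybe.map suc (minSupp (content k (concat T)))
      ≡⟨ cong (λ c → just (suc i) <∞ Maybe.map suc (minSupp c)) content-T ⟩
    just (suc i) <∞ Maybe.map suc (minSupp q)
      ≡⟨ <∞-suc i (minSupp q) ⟩
    just i <∞ minSupp q
      ≡⟨ cong (_<∞ minSupp q)
              (minSupp-content k i r (All.tail (weaklyIncr-head≤ (suc i) r w-true)) i<k) ⟨
    M ∎
    where
    content-T : content k (concat T) ≡ q
    content-T = trans (cong (λ n → content n (concat T)) (sym length-q))
                      (listEqᵇ-true⇒≡ _ q (trans (sym (hasContent-content q T))
                                                 (∧-true⇒ʳ {isImmaculate T} IE)))

  split : ∀ T → IsFilling k T → ⟦ isImmaculate (row ∷ T) ∧ hasContent v (row ∷ T) ⟧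
                              ≡ ⟦ w ∧ l ⟧ * (⟦ M ⟧ * ⟦ isImmaculate T ∧ hasContent q T ⟧)
  split T T-filling = begin
    ⟦ isImmaculate (row ∷ T) ∧ hasContent v (row ∷ T) ⟧
      ≡⟨ cong₂ (λ b c → ⟦ b ∧ c ⟧) (isImmaculate-∷ (suc i) r T) (hasContent-∷ v row T) ⟩
    ⟦ (w ∧ (a ∧ I)) ∧ (l ∧ E) ⟧
      ≡⟨ cong ⟦_⟧ (∧-interchange w (a ∧ I) l E) ⟩
    ⟦ (w ∧ l) ∧ ((a ∧ I) ∧ E) ⟧
      ≡⟨ cong (λ b → ⟦ (w ∧ l) ∧ b ⟧) (∧-assoc a I E) ⟩
    ⟦ (w ∧ l) ∧ (a ∧ (I ∧ E)) ⟧
      ≡⟨ cong ⟦_⟧ (∧-cong-when (w ∧ l) a M (I ∧ E)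
                                λ wl → head-condition T T-filling (∧-true⇒ˡ wl)) ⟩
    ⟦ (w ∧ l) ∧ (M ∧ (I ∧ E)) ⟧
      ≡⟨ ⟦∧⟧ (w ∧ l) (M ∧ (I ∧ E)) ⟩
    ⟦ w ∧ l ⟧ * ⟦ M ∧ (I ∧ E) ⟧
      ≡⟨ cong (⟦ w ∧ l ⟧ *_) (⟦∧⟧ M (I ∧ E)) ⟩
    ⟦ w ∧ l ⟧ * (⟦ M ⟧ * ⟦ I ∧ E ⟧) ∎
    where
    a = just (suc i) <∞ head (firstColumn T)
    I = isImmaculate T
    E = hasContent q T

K-∷ : ∀ a α v → All (0 <_) α →
  K (suc a ∷ α) v ≡ ∑ (firstRowWeight v (completions α v)) (allRows (suc a) (length v))
K-∷ a α v α>0 = begin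
  K (suc a ∷ α) v
    ≡⟨ length-filter P (allFillings (suc a ∷ α) k) ⟩
  ∑ (⟦_⟧ ∘ P) (allFillings (suc a ∷ α) k)
    ≡⟨ ∑-concatMap-∷ (⟦_⟧ ∘ P) id (λ _ → allFillings α k) (allRows (suc a) k) ⟩
  ∑ (λ r → ∑ (λ T → ⟦ P (r ∷ T) ⟧) (allFillings α k)) (allRows (suc a) k)
    ≡⟨ ∑-cong-All (allRows-shape (suc a) k)
                  (λ r (len , range) → ∑-first-row α v r α>0 (subst (0 <_) (sym len) z<s) range) ⟩
  ∑ (firstRowWeight v (completions α v)) (allRows (suc a) k) ∎
  where
  open ≡-Reasoning
  k = length v
  P : List (List ℕ) → Bool
  P T = isImmaculate T ∧ hasContent v T

≺ℕ-term : (Monomial → ℕ) → (Monomial → ℕ) → Monomial → Monomial → ℕ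
≺ℕ-term f g w m = if minSupp m <∞ minSupp (quot w m) then f m * g (quot w m) else 0

_≺ℕ_ : (Monomial → ℕ) → (Monomial → ℕ) → Monomial → ℕ
(f ≺ℕ g) w = ∑ (≺ℕ-term f g w) (divisors w)

hℕ : ℕ → Monomial → ℕ
hℕ n w = ⟦ deg w ≡ᵇ n ⟧

nestedHℕ : List ℕ → Monomial → ℕ
nestedHℕ [] = hℕ 0
nestedHℕ (a ∷ α) = hℕ a ≺ℕ nestedHℕ α

K≡nestedHℕ : ∀ α → All (0 <_) α → ∀ v → K α v ≡ nestedHℕ α v
K≡nestedHℕ [] _ v = begin
  K [] v
    ≡⟨ length-filter (λ T → isImmaculate T ∧ hasContent v T) ([] ∷ []) ⟩
  ⟦ hasContent v [] ⟧ + 0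
    ≡⟨ +-identityʳ _ ⟩
  ⟦ hasContent v [] ⟧
    ≡⟨ cong ⟦_⟧ (trans (hasContent-content v []) (contentFrom-[]≡ᵇ 1 v)) ⟩
  ⟦ sum v ≡ᵇ 0 ⟧ ∎
  where open ≡-Reasoning
K≡nestedHℕ (zero ∷ α) (() ∷ _) v
K≡nestedHℕ (suc a ∷ α) (_ ∷ α>0) v = begin
  K (suc a ∷ α) v
    ≡⟨ K-∷ a α v α>0 ⟩
  ∑ (firstRowWeight v (completions α v)) (allRows (suc a) (length v))
    ≡⟨ ∑-rows≡∑-divisors v (suc a) (completions α v) ⟩
  ∑ (λ m → ⟦ sum m ≡ᵇ suc a ⟧ * completions α v m) (divisors v)
    ≡⟨ ∑-cong (divisors v) term ⟩
  nestedHℕ (suc a ∷ α) v ∎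
  where
  open ≡-Reasoning
  term : ∀ m → ⟦ sum m ≡ᵇ suc a ⟧ * completions α v m
             ≡ ≺ℕ-term (hℕ (suc a)) (nestedHℕ α) v m
  term m with minSupp m <∞ minSupp (quot v m)
  ... | true = cong (⟦ sum m ≡ᵇ suc a ⟧ *_) (trans (+-identityʳ _) (K≡nestedHℕ α α>0 (quot v m)))
  ... | false = *-zeroʳ ⟦ sum m ≡ᵇ suc a ⟧

-- Zero exponents and degrees

∑-divisors-++ : (f : Monomial → ℕ) (p q : Monomial) →
  ∑ f (divisors (p ++ q)) ≡ ∑ (λ d → ∑ (λ e → f (d ++ e)) (divisors q)) (divisors p)
∑-divisors-++ f [] q = sym (+-identityʳ _)
∑-divisors-++ f (x ∷ p) q = begin
  ∑ f (divisors (x ∷ (p ++ q)))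
    ≡⟨ ∑-concatMap-∷ f id (λ _ → divisors (p ++ q)) (upTo (suc x)) ⟩
  ∑ (λ a → ∑ (f ∘ (a ∷_)) (divisors (p ++ q))) (upTo (suc x))
    ≡⟨ ∑-cong (upTo (suc x)) (λ a → ∑-divisors-++ (f ∘ (a ∷_)) p q) ⟩
  ∑ (λ a → ∑ (λ d → ∑ (λ e → f (a ∷ d ++ e)) (divisors q)) (divisors p)) (upTo (suc x))
    ≡⟨ ∑-concatMap-∷ (λ d → ∑ (λ e → f (d ++ e)) (divisors q)) id (λ _ → divisors p)
                     (upTo (suc x)) ⟨
  ∑ (λ d → ∑ (λ e → f (d ++ e)) (divisors q)) (divisors (x ∷ p)) ∎
  where open ≡-Reasoning

∑-divisors-0∷ : (f : Monomial → ℕ) (q : Monomial) →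
  ∑ f (divisors (0 ∷ q)) ≡ ∑ (f ∘ (0 ∷_)) (divisors q)
∑-divisors-0∷ f q = trans (∑-concatMap-∷ f id (λ _ → divisors q) (upTo 1)) (+-identityʳ _)

deg-divisors : ∀ w → All (λ m → deg (quot w m) + deg m ≡ deg w) (divisors w)
deg-divisors [] = refl ∷ []
deg-divisors (e ∷ w) = All-concatMap _ (all-upTo (suc e)) (λ {a} a≤e →
  map⁺ (All.map (λ {m} deg≡ → trans (+-interchange (e ∸ a) (deg (quot w m)) a (deg m))
                                     (cong₂ _+_ (m∸n+n≡m (s≤s⁻¹ a≤e)) deg≡))
                (deg-divisors w)))

quot-++ : ∀ p d q e → length d ≡ length p → quot (p ++ q) (d ++ e) ≡ quot p d ++ quot q e
quot-++ [] [] q e _ = refl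
quot-++ (x ∷ p) (y ∷ d) q e len = cong ((x ∸ y) ∷_) (quot-++ p d q e (suc-injective len))

deg-insert-0 : ∀ d e → deg (d ++ 0 ∷ e) ≡ deg (d ++ e)
deg-insert-0 d e = trans (sum-++ d (0 ∷ e)) (sym (sum-++ d e))

punchInℕ : ℕ → ℕ → ℕ
punchInℕ zero i = suc i
punchInℕ (suc n) zero = zero
punchInℕ (suc n) (suc i) = suc (punchInℕ n i)

minSupp-insert-0 : ∀ d e → minSupp (d ++ 0 ∷ e) ≡ Maybe.map (punchInℕ (length d)) (minSupp (d ++ e))
minSupp-insert-0 [] e = minSupp-0∷ e
minSupp-insert-0 (zero ∷ d) e = begin
  minSupp (0 ∷ d ++ 0 ∷ e)
    ≡⟨ minSupp-0∷ (d ++ 0 ∷ e) ⟩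
  Maybe.map suc (minSupp (d ++ 0 ∷ e))
    ≡⟨ cong (Maybe.map suc) (minSupp-insert-0 d e) ⟩
  Maybe.map suc (Maybe.map (punchInℕ n) (minSupp (d ++ e)))
    ≡⟨ commute (minSupp (d ++ e)) ⟩
  Maybe.map (punchInℕ (suc n)) (Maybe.map suc (minSupp (d ++ e)))
    ≡⟨ cong (Maybe.map (punchInℕ (suc n))) (minSupp-0∷ (d ++ e)) ⟨
  Maybe.map (punchInℕ (suc n)) (minSupp (0 ∷ d ++ e)) ∎
  where
  open ≡-Reasoning
  n = length d
  commute : ∀ x → Maybe.map suc (Maybe.map (punchInℕ n) x) ≡ Maybe.map (punchInℕ (suc n)) (Maybe.map suc x)
  commute nothing = refl
  commute (just j) = refl
minSupp-insert-0 (suc a ∷ d) e = refl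

<ᵇ-punchInℕ : ∀ n i j → (punchInℕ n i <ᵇ punchInℕ n j) ≡ (i <ᵇ j)
<ᵇ-punchInℕ zero i j = refl
<ᵇ-punchInℕ (suc n) zero zero = refl
<ᵇ-punchInℕ (suc n) zero (suc j) = refl
<ᵇ-punchInℕ (suc n) (suc i) zero = refl
<ᵇ-punchInℕ (suc n) (suc i) (suc j) = <ᵇ-punchInℕ n i j

<∞-punchInℕ : ∀ n x y → (Maybe.map (punchInℕ n) x <∞ Maybe.map (punchInℕ n) y) ≡ (x <∞ y)
<∞-punchInℕ n nothing y = refl
<∞-punchInℕ n (just i) nothing = refl
<∞-punchInℕ n (just i) (just j) = <ᵇ-punchInℕ n i j

-- A zero exponent inserted at position |p| shifts all later variable indices by one,
-- which preserves degrees and the order of minimal supports.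
nestedHℕ-insert-0 : ∀ α p q → nestedHℕ α (p ++ 0 ∷ q) ≡ nestedHℕ α (p ++ q)
nestedHℕ-insert-0 [] p q = cong (λ n → ⟦ n ≡ᵇ 0 ⟧) (deg-insert-0 p q)
nestedHℕ-insert-0 (a ∷ α) p q = begin
  ∑ (term (p ++ 0 ∷ q)) (divisors (p ++ 0 ∷ q))
    ≡⟨ ∑-divisors-++ (term (p ++ 0 ∷ q)) p (0 ∷ q) ⟩
  ∑ (λ d → ∑ (λ e → term (p ++ 0 ∷ q) (d ++ e)) (divisors (0 ∷ q))) (divisors p)
    ≡⟨ ∑-cong (divisors p) (λ d → ∑-divisors-0∷ (λ e → term (p ++ 0 ∷ q) (d ++ e)) q) ⟩
  ∑ (λ d → ∑ (λ e → term (p ++ 0 ∷ q) (d ++ 0 ∷ e)) (divisors q)) (divisors p)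
    ≡⟨ ∑-cong-All (length-divisors p) (λ d len → ∑-cong (divisors q) (λ e → insert-0 d e len)) ⟩
  ∑ (λ d → ∑ (λ e → term (p ++ q) (d ++ e)) (divisors q)) (divisors p)
    ≡⟨ ∑-divisors-++ (term (p ++ q)) p q ⟨
  ∑ (term (p ++ q)) (divisors (p ++ q)) ∎
  where
  open ≡-Reasoning
  term = ≺ℕ-term (hℕ a) (nestedHℕ α)
  insert-0 : ∀ d e → length d ≡ length p → term (p ++ 0 ∷ q) (d ++ 0 ∷ e) ≡ term (p ++ q) (d ++ e)
  insert-0 d e len
    rewrite quot-++ p d (0 ∷ q) (0 ∷ e) len | quot-++ p d q e len
          | minSupp-insert-0 d e | minSupp-insert-0 (quot p d) (quot q e) | length-quot p d len
          | <∞-punchInℕ (length d) (minSupp (d ++ e)) (minSupp (quot p d ++ quot q e))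
          | deg-insert-0 d e | nestedHℕ-insert-0 α (quot p d) (quot q e) = refl

nestedHℕ-nonzeroExps : ∀ α p z → nestedHℕ α (p ++ z) ≡ nestedHℕ α (p ++ nonzeroExps z)
nestedHℕ-nonzeroExps α p [] = refl
nestedHℕ-nonzeroExps α p (zero ∷ z) = trans (nestedHℕ-insert-0 α p z) (nestedHℕ-nonzeroExps α p z)
nestedHℕ-nonzeroExps α p (suc a ∷ z) = begin
  nestedHℕ α (p ++ suc a ∷ z)
    ≡⟨ cong (nestedHℕ α) (++-assoc p (suc a ∷ []) z) ⟨
  nestedHℕ α ((p ++ suc a ∷ []) ++ z)
    ≡⟨ nestedHℕ-nonzeroExps α (p ++ suc a ∷ []) z ⟩
  nestedHℕ α ((p ++ suc a ∷ []) ++ nonzeroExps z)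
    ≡⟨ cong (nestedHℕ α) (++-assoc p (suc a ∷ []) (nonzeroExps z)) ⟩
  nestedHℕ α (p ++ suc a ∷ nonzeroExps z) ∎
  where open ≡-Reasoning

nestedHℕ-deg : ∀ α w → deg w ≢ sum α → nestedHℕ α w ≡ 0
nestedHℕ-deg [] w deg≢0 rewrite ≢⇒≡ᵇ-false (deg w) 0 deg≢0 = refl
nestedHℕ-deg (a ∷ α) w deg≢ = trans (∑-cong-All (deg-divisors w) term≡0) (∑-0 (divisors w))
  where
  term≡0 : ∀ m → deg (quot w m) + deg m ≡ deg w → ≺ℕ-term (hℕ a) (nestedHℕ α) w m ≡ 0
  term≡0 m deg-split with minSupp m <∞ minSupp (quot w m) | deg m ≟ a
  ... | false | _ = refl
  ... | true | no deg≢a rewrite ≢⇒≡ᵇ-false (deg m) a deg≢a = refl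
  ... | true | yes refl rewrite ≡ᵇ-refl (deg m) =
    trans (+-identityʳ _) (nestedHℕ-deg α (quot w m)
      (λ deg≡ → deg≢ (trans (sym deg-split) (trans (cong (_+ deg m) deg≡) (+-comm (sum α) (deg m))))))

sum-nonzeroExps : ∀ w → sum (nonzeroExps w) ≡ deg w
sum-nonzeroExps [] = refl
sum-nonzeroExps (zero ∷ w) = sum-nonzeroExps w
sum-nonzeroExps (suc a ∷ w) = cong (suc a +_) (sum-nonzeroExps w)

nonzeroExps-positive : ∀ w → All (0 <_) (nonzeroExps w)
nonzeroExps-positive [] = []
nonzeroExps-positive (zero ∷ w) = nonzeroExps-positive w
nonzeroExps-positive (suc a ∷ w) = z<s ∷ nonzeroExps-positive w

dualImmℕ : List ℕ → Monomial → ℕ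
dualImmℕ α w = ∑ (λ β → K α β * ⟦ listEqᵇ (nonzeroExps w) β ⟧) (compositions (sum α))

dualImmℕ≡nestedHℕ : ∀ α → All (0 <_) α → ∀ w → dualImmℕ α w ≡ nestedHℕ α w
dualImmℕ≡nestedHℕ α α>0 w = begin
  ∑ (λ β → K α β * ⟦ listEqᵇ x β ⟧) (compositions (sum α))
    ≡⟨ ∑-cong (compositions (sum α)) (λ β → *-comm (K α β) _) ⟩
  ∑ (λ β → ⟦ listEqᵇ x β ⟧ * K α β) (compositions (sum α))
    ≡⟨ ∑-select-compositionsF (sum α) (sum α) x (K α) ≤-refl (nonzeroExps-positive w) ⟩
  ⟦ sum x ≡ᵇ sum α ⟧ * K α x
    ≡⟨ cong₂ (λ n c → ⟦ n ≡ᵇ sum α ⟧ * c) (sum-nonzeroExps w)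
             (trans (K≡nestedHℕ α α>0 x) (sym (nestedHℕ-nonzeroExps α [] w))) ⟩
  ⟦ deg w ≡ᵇ sum α ⟧ * nestedHℕ α w
    ≡⟨ degree-filter ⟩
  nestedHℕ α w ∎
  where
  open ≡-Reasoning
  x = nonzeroExps w
  degree-filter : ⟦ deg w ≡ᵇ sum α ⟧ * nestedHℕ α w ≡ nestedHℕ α w
  degree-filter with deg w ≟ sum α
  ... | yes deg≡ rewrite deg≡ | ≡ᵇ-refl (sum α) = +-identityʳ _
  ... | no deg≢ rewrite ≢⇒≡ᵇ-false (deg w) (sum α) deg≢ = sym (nestedHℕ-deg α w deg≢)

-- Passing to the coefficient ring

module _ {c ℓ : Level} (R : CommutativeRing c ℓ) where
  open CommutativeRing R using (Carrier; _≈_; 0#; 1#) renaming (_+_ to _⊕_; _*_ to _⊗_)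
  module R = CommutativeRing R
  open PowerSeries R

  ι-+ : ∀ m n → ι (m + n) ≈ ι m ⊕ ι n
  ι-+ zero n = R.sym (R.+-identityˡ _)
  ι-+ (suc m) n = R.trans (R.+-congˡ (ι-+ m n)) (R.sym (R.+-assoc _ _ _))

  ι-* : ∀ m n → ι (m * n) ≈ ι m ⊗ ι n
  ι-* zero n = R.sym (R.zeroˡ _)
  ι-* (suc m) n = R.trans (ι-+ n (m * n))
    (R.trans (R.+-cong (R.sym (R.*-identityˡ _)) (ι-* m n)) (R.sym (R.distribʳ _ _ _)))

  ι-⟦⟧ : ∀ b → [ b ]ᴿ ≈ ι ⟦ b ⟧
  ι-⟦⟧ true = R.sym (R.+-identityʳ 1#)
  ι-⟦⟧ false = R.refl

  Σᴿ-ι : (f : A → Carrier) (g : A → ℕ) (xs : List A) →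
    (∀ x → f x ≈ ι (g x)) → Σᴿ (map f xs) ≈ ι (∑ g xs)
  Σᴿ-ι f g [] f≈ = R.refl
  Σᴿ-ι f g (x ∷ xs) f≈ =
    R.trans (R.+-cong (f≈ x) (Σᴿ-ι f g xs f≈)) (R.sym (ι-+ (g x) (∑ g xs)))

  ≺-ι : ∀ {f g} (f′ g′ : Monomial → ℕ) →
    f ≋ (ι ∘ f′) → g ≋ (ι ∘ g′) → (f ≺ g) ≋ (ι ∘ (f′ ≺ℕ g′))
  ≺-ι {f} {g} f′ g′ f≈ g≈ w = Σᴿ-ι _ _ (divisors w) term
    where
    term : ∀ m → (if minSupp m <∞ minSupp (quot w m) then f m ⊗ g (quot w m) else 0#)
               ≈ ι (≺ℕ-term f′ g′ w m)
    term m with minSupp m <∞ minSupp (quot w m)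
    ... | true = R.trans (R.*-cong (f≈ m) (g≈ (quot w m))) (R.sym (ι-* (f′ m) (g′ (quot w m))))
    ... | false = R.refl

  nestedH≈ι : ∀ α → nestedH α ≋ (ι ∘ nestedHℕ α)
  nestedH≈ι [] w = ι-⟦⟧ (deg w ≡ᵇ 0)
  nestedH≈ι (a ∷ α) = ≺-ι (hℕ a) (nestedHℕ α) (λ m → ι-⟦⟧ (deg m ≡ᵇ a)) (nestedH≈ι α)

  dualImm≈ι : ∀ α → dualImm α ≋ (ι ∘ dualImmℕ α)
  dualImm≈ι α w = Σᴿ-ι _ _ (compositions (sum α)) λ β →
    R.trans (R.*-congˡ (ι-⟦⟧ (listEqᵇ (nonzeroExps w) β)))
            (R.sym (ι-* (K α β) ⟦ listEqᵇ (nonzeroExps w) β ⟧))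

corollary4p7 : {c ℓ : Level} (R : CommutativeRing c ℓ) (α : List ℕ) →
    All (0 <_) α →
    PowerSeries._≋_ R (PowerSeries.dualImm R α) (PowerSeries.nestedH R α)
corollary4p7 R α α>0 w = begin
  dualImm α w       ≈⟨ dualImm≈ι R α w ⟩
  ι (dualImmℕ α w)  ≡⟨ cong ι (dualImmℕ≡nestedHℕ α α>0 w) ⟩
  ι (nestedHℕ α w)  ≈⟨ nestedH≈ι R α w ⟨
  nestedH α w       ∎
  where
  open PowerSeries R
  open import Relation.Binary.Reasoning.Setoid (CommutativeRing.setoid R)
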